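{- For every $\epsilon>0$ there exists $n_0$ such that for all $n>n_0$ we have $f(n,6)\le n^{1+\epsilon}$.
   Context: $Q_n$ denotes the $n$-dimensional hypercube: its vertices are the binary vectors of length $n$, two vertices adjacent iff they differ in exactly one coordinate. $f(n,6)$ is the minimum number of colors in an edge-coloring of $Q_n$ such that the edges of every copy of the 6-cycle $C_6$ in $Q_n$ receive 6 distinct colors.
   Formalization: The parameter ε ranges over the positive rationals. -}

module Defs where

open import Data.Nat using (ℕ; suc; _≤_; _^_; _+_; _<_)
open import Data.Bool using (Bool; not)
open import Data.Fin using (Fin; zero; suc)
open import Data.Vec using (Vec; updateAt)
open import Data.Product using (Σ; _×_; ∃; ∃-syntax)
open import Function.Definitions using (Injective)
open import Relation.Binary.PropositionalEquality using (_≡_)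

Vertex : ℕ → Set
Vertex n = Vec Bool n

flipAt : ∀ {n} → Vertex n → Fin n → Vertex n
flipAt v i = updateAt v i not

-- An edge of Q_n is determined by an endpoint v and the coordinate i in
-- which its two endpoints v and flipAt v i differ.
record EdgeColoring (n k : ℕ) : Set where
  field
    color      : Vertex n → Fin n → Fin k
    wellDefined : ∀ v i → color v i ≡ color (flipAt v i) i
open EdgeColoring public

next6 : Fin 6 → Fin 6
next6 zero = suc zero
next6 (suc zero) = suc (suc zero)
next6 (suc (suc zero)) = suc (suc (suc zero))
next6 (suc (suc (suc zero))) = suc (suc (suc (suc zero)))
next6 (suc (suc (suc (suc zero)))) = suc (suc (suc (suc (suc zero))))
next6 (suc (suc (suc (suc (suc zero))))) = zero

record C6Copy (n : ℕ) : Set where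
  field
    w     : Fin 6 → Vertex n
    d     : Fin 6 → Fin n
    w-inj : Injective _≡_ _≡_ w
    steps : ∀ j → w (next6 j) ≡ flipAt (w j) (d j)
open C6Copy public

C6Rainbow : ∀ {n k} → EdgeColoring n k → Set
C6Rainbow {n} c = (C : C6Copy n) →
  Injective _≡_ _≡_ (λ j → color c (w C j) (d C j))

-- f(n,6) ≤ N  iff  some C6-rainbow edge-coloring of Q_n uses at most N colors.
-- "f(n,6) ≤ n^(1 + p/q)" is equivalent (all quantities nonnegative) to
-- f(n,6)^q ≤ n^(q+p); we state it in that form.
f6Bound : (n p q : ℕ) → Set
f6Bound n p q = ∃[ k ] (Σ (EdgeColoring n k) C6Rainbow × (k ^ q ≤ n ^ (q + p)))

-- Colour the edge of Q_n between v and v + eᵢ by the residues of W(v) + W(v + eᵢ) modulo 6(B + 1),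
-- where W ranges over a family of weightings of the coordinates by numbers at most B, together with the
-- Hamming weight (all weights 1). Along a walk W changes by ±W(d) at each step in direction d, the sign
-- being the flipped bit; so if edges j and j + m (m ≤ 3) of a 6-cycle get the same colour, a signed sum of
-- 2m ≤ 6 such steps vanishes modulo 6(B + 1), hence vanishes. For the Hamming weight this pins down the
-- signs, and for the other weightings it leaves an equation W(p) + W(q) = W(r) + W(r) between directions
-- with p ≠ r (for m = 3 using that some direction of a 6-cycle recurs after 2 or 3 steps). Behrend's
-- weightings, the L digits of a coordinate in base e + 1 and the sum of their squares, admit no such
-- equation by strict convexity of the square. With e^L ≤ n < (e + 1)^L this takes O(e^(L+2)) colours,
-- which is at most n^(1 + p/q) for L = 2q + 1 and n large.

module Submission where

open import Defs
open import Data.Bool using (Bool; true; false; not)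
open import Data.Bool.Properties using (not-involutive; not-injective; not-¬)
open import Data.Fin using (Fin; zero; suc; _≟_; toℕ; inject≤; combine; funToFin; finToFun)
open import Data.Fin.Properties
  using (toℕ-injective; toℕ-inject≤; toℕ≤pred[n]; toℕ-fromℕ<; combine-injective; funToFin-finToFin; finToFun-funToFin)
open import Data.Fin.Patterns using (0F; 1F; 2F; 3F; 4F; 5F)
open import Data.Integer as ℤ using (ℤ; +_; 0ℤ; 1ℤ; -1ℤ; -_; ∣_∣) renaming (_+_ to _+ℤ_; _-_ to _-ℤ_; _*_ to _*ℤ_)
import Data.Integer.Properties as ℤ
open import Data.Integer.Tactic.RingSolver using (solve-∀)
import Data.Nat.Tactic.RingSolver as ℕ-Solver
open import Data.Nat
  using (ℕ; zero; suc; _+_; _*_; _^_; _≤_; _<_; _<?_; _%_; _/_; NonZero; >-nonZero; z≤n; s≤s; s≤s⁻¹)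
  renaming (∣_-_∣ to ∣_-_∣ℕ)
open import Data.Nat.DivMod using (_mod_; m%n<n; m≡m%n+[m/n]*n; [m+kn]%n≡m%n; m<n⇒m%n≡m)
open import Data.Nat.Properties
  using ( +-comm; +-assoc; +-identityʳ; +-cancelˡ-≡; *-identityˡ; *-identityʳ; *-distribˡ-+; *-cancelˡ-≡
        ; ≤-refl; ≤-reflexive; ≤-trans; ≤-antisym; ≤-total; <-trans; <⇒≤; <⇒≱; ≮⇒≥; n<1+n; m≤n⇒m≤1+n
        ; +-mono-≤; +-monoˡ-≤; +-monoʳ-≤; *-mono-≤; *-monoˡ-≤; *-monoʳ-≤; m≤m+n; m≤n+m; m<n+m; m≤m*n
        ; ^-monoˡ-≤; ^-monoʳ-≤; ^-monoˡ-<; ^-zeroˡ; ^-distribˡ-+-*; ^-*-assoc; m^n>0; m^n≢0; m*n≢0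
        ; m≤n⇒∃[o]m+o≡n; ∣m-m+n∣≡n; ∣-∣-comm; ∣m-n∣≡0⇒m≡n; m*n≡0⇒m≡0∨n≡0; n≤0⇒n≡0; 1+n≢0
        ; +-0-commutativeMonoid; module ≤-Reasoning )
open import Data.Vec using ([]; _∷_; lookup)
open import Data.Vec.Properties using (lookup∘updateAt; lookup∘updateAt′)
open import Data.Empty using (⊥; ⊥-elim)
open import Data.Product using (_×_; _,_; proj₁; proj₂; ∃-syntax)
open import Data.Sum using (_⊎_; inj₁; inj₂; reduce)
open import Function using (_∘_)
open import Algebra.Properties.CommutativeMonoid.Sum +-0-commutativeMonoid using (sum; ∑-distrib-+; sum-cong-≗)
open import Relation.Binary.PropositionalEquality
open import Relation.Nullary using (¬_; yes; no)

lookup-flipAt-≡ : ∀ {n} (v : Vertex n) i → lookup (flipAt v i) i ≡ not (lookup v i)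
lookup-flipAt-≡ v i = lookup∘updateAt i v

lookup-flipAt-≢ : ∀ {n} (v : Vertex n) {i k} → k ≢ i → lookup (flipAt v i) k ≡ lookup v k
lookup-flipAt-≢ v {i} {k} k≢i = lookup∘updateAt′ k i k≢i v

flipAt-involutive : ∀ {n} (v : Vertex n) i → flipAt (flipAt v i) i ≡ v
flipAt-involutive (b ∷ v) zero    = cong (_∷ v) (not-involutive b)
flipAt-involutive (b ∷ v) (suc i) = cong (b ∷_) (flipAt-involutive v i)

-- Weights of hypercube vertices

bitValue : Bool → ℕ → ℕ
bitValue false x = 0
bitValue true  x = x

weight : ∀ {n} → (Fin n → ℕ) → Vertex n → ℕ
weight X []      = 0
weight X (b ∷ v) = bitValue b (X zero) + weight (λ k → X (suc k)) v

sgn : Bool → ℤ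
sgn false = 1ℤ
sgn true  = -1ℤ

weight-flipAt : ∀ {n} (X : Fin n → ℕ) v i →
  + weight X (flipAt v i) ≡ + weight X v +ℤ sgn (lookup v i) *ℤ + X i
weight-flipAt X (false ∷ v) zero =
  trans (ℤ.pos-+ (X zero) _) (raise (+ X zero) (+ weight _ v))
  where
  raise : ∀ x w → x +ℤ w ≡ + 0 +ℤ w +ℤ 1ℤ *ℤ x
  raise = solve-∀
weight-flipAt X (true ∷ v) zero =
  trans (lower (+ X zero) (+ weight _ v)) (cong (_+ℤ -1ℤ *ℤ + X zero) (sym (ℤ.pos-+ (X zero) _)))
  where
  lower : ∀ x w → + 0 +ℤ w ≡ x +ℤ w +ℤ -1ℤ *ℤ x
  lower = solve-∀
weight-flipAt X (b ∷ v) (suc i) = begin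
  + (bitValue b x₀ + weight X′ (flipAt v i))   ≡⟨ ℤ.pos-+ (bitValue b x₀) _ ⟩
  + bitValue b x₀ +ℤ + weight X′ (flipAt v i)  ≡⟨ cong (+ bitValue b x₀ +ℤ_) (weight-flipAt X′ v i) ⟩
  + bitValue b x₀ +ℤ (+ weight X′ v +ℤ δ)      ≡⟨ ℤ.+-assoc (+ bitValue b x₀) (+ weight X′ v) δ ⟨
  + bitValue b x₀ +ℤ + weight X′ v +ℤ δ        ≡⟨ cong (_+ℤ δ) (ℤ.pos-+ (bitValue b x₀) _) ⟨
  + (bitValue b x₀ + weight X′ v) +ℤ δ         ∎
  where
  open ≡-Reasoning
  x₀ : ℕ
  x₀ = X zero
  X′ : Fin _ → ℕ
  X′ k = X (suc k)
  δ : ℤ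
  δ = sgn (lookup v i) *ℤ + X′ i

edgeWeight : ∀ {n} → (Fin n → ℕ) → Vertex n → Fin n → ℕ
edgeWeight X v i = weight X v + weight X (flipAt v i)

edgeWeight-flipAt : ∀ {n} (X : Fin n → ℕ) v i → edgeWeight X (flipAt v i) i ≡ edgeWeight X v i
edgeWeight-flipAt X v i =
  trans (cong (λ u → weight X (flipAt v i) + weight X u) (flipAt-involutive v i))
        (+-comm (weight X (flipAt v i)) (weight X v))

-- Drifts along walks and their sign patterns

sgn-not : ∀ b → sgn (not b) ≡ - sgn b
sgn-not false = refl
sgn-not true  = refl

sgn-cancel : ∀ b {z} → sgn b *ℤ z ≡ 0ℤ → z ≡ 0ℤ
sgn-cancel false {z} eq = trans (sym (ℤ.*-identityˡ z)) eq
sgn-cancel true  {z} eq =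
  trans (sym (ℤ.neg-involutive z)) (cong -_ (trans (sym (ℤ.-1*i≡-i z)) eq))

sgn-cancel-+ : ∀ s a b c d → sgn s *ℤ ((+ a +ℤ + b) -ℤ (+ c +ℤ + d)) ≡ 0ℤ → a + b ≡ c + d
sgn-cancel-+ s a b c d eq = ℤ.+-injective (begin
  + (a + b)   ≡⟨ ℤ.pos-+ a b ⟩
  + a +ℤ + b  ≡⟨ ℤ.i-j≡0⇒i≡j _ _ (sgn-cancel s eq) ⟩
  + c +ℤ + d  ≡⟨ ℤ.pos-+ c d ⟨
  + (c + d)   ∎)
  where open ≡-Reasoning

-- The change of the edge value P j + P (j + 1) over m steps of a walk whose potential P moves by δ.
drift : (ℕ → ℤ) → ℕ → ℤ
drift δ zero    = 0ℤ
drift δ (suc m) = drift δ m +ℤ (δ m +ℤ δ (suc m))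

signed : (ℕ → Bool) → (ℕ → ℕ) → ℕ → ℤ
signed b x j = sgn (b j) *ℤ + x j

balanced₁ : ∀ b → drift (signed b (λ _ → 1)) 1 ≡ 0ℤ → b 1 ≡ not (b 0)
balanced₁ b = check (b 0) (b 1)
  where
  check : ∀ b₀ b₁ → 0ℤ +ℤ (sgn b₀ *ℤ 1ℤ +ℤ sgn b₁ *ℤ 1ℤ) ≡ 0ℤ → b₁ ≡ not b₀
  check false false ()
  check false true  _ = refl
  check true  false _ = refl
  check true  true  ()

balanced₂ : ∀ b → drift (signed b (λ _ → 1)) 2 ≡ 0ℤ → b 1 ≡ not (b 0) × b 2 ≡ b 0
balanced₂ b = check (b 0) (b 1) (b 2)
  where
  check : ∀ b₀ b₁ b₂ →
    0ℤ +ℤ (sgn b₀ *ℤ 1ℤ +ℤ sgn b₁ *ℤ 1ℤ) +ℤ (sgn b₁ *ℤ 1ℤ +ℤ sgn b₂ *ℤ 1ℤ) ≡ 0ℤ → b₁ ≡ not b₀ × b₂ ≡ b₀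
  check false false false ()
  check false false true  ()
  check false true  false _ = refl , refl
  check false true  true  ()
  check true  false false ()
  check true  false true  _ = refl , refl
  check true  true  false ()
  check true  true  true  ()

balanced₃ : ∀ b → drift (signed b (λ _ → 1)) 3 ≡ 0ℤ → b 2 ≡ not (b 1) × b 3 ≡ not (b 0)
balanced₃ b = check (b 0) (b 1) (b 2) (b 3)
  where
  check : ∀ b₀ b₁ b₂ b₃ →
    0ℤ +ℤ (sgn b₀ *ℤ 1ℤ +ℤ sgn b₁ *ℤ 1ℤ) +ℤ (sgn b₁ *ℤ 1ℤ +ℤ sgn b₂ *ℤ 1ℤ) +ℤ (sgn b₂ *ℤ 1ℤ +ℤ sgn b₃ *ℤ 1ℤ) ≡ 0ℤ →
    b₂ ≡ not b₁ × b₃ ≡ not b₀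
  check false false false false ()
  check false false false true  ()
  check false false true  false ()
  check false false true  true  _ = refl , refl
  check false true  false false ()
  check false true  false true  _ = refl , refl
  check false true  true  false ()
  check false true  true  true  ()
  check true  false false false ()
  check true  false true  false _ = refl , refl
  check true  false false true  ()
  check true  false true  true  ()
  check true  true  false false _ = refl , refl
  check true  true  false true  ()
  check true  true  true  false ()
  check true  true  true  true  ()

drift₁≡0 : ∀ b x → b 1 ≡ not (b 0) → drift (signed b x) 1 ≡ 0ℤ → x 0 ≡ x 1
drift₁≡0 b x b₁ eq =
  ℤ.+-injective (ℤ.i-j≡0⇒i≡j _ _ (sgn-cancel (b 0) (factor (sgn (b 0)) (sgn (b 1)) s₁ (+ x 0) (+ x 1) eq)))
  where
  s₁ : sgn (b 1) ≡ - sgn (b 0)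
  s₁ = trans (cong sgn b₁) (sgn-not (b 0))
  identity : ∀ s a c → 0ℤ +ℤ (s *ℤ a +ℤ (- s) *ℤ c) ≡ s *ℤ (a -ℤ c)
  identity = solve-∀
  factor : ∀ s s₁ → s₁ ≡ - s → ∀ a c → 0ℤ +ℤ (s *ℤ a +ℤ s₁ *ℤ c) ≡ 0ℤ → s *ℤ (a -ℤ c) ≡ 0ℤ
  factor s _ refl a c = trans (sym (identity s a c))

drift₂≡0 : ∀ b x → b 1 ≡ not (b 0) → b 2 ≡ b 0 → drift (signed b x) 2 ≡ 0ℤ → x 0 + x 2 ≡ x 1 + x 1
drift₂≡0 b x b₁ b₂ eq =
  sgn-cancel-+ (b 0) (x 0) (x 2) (x 1) (x 1)
    (factor (sgn (b 0)) (sgn (b 1)) (sgn (b 2)) s₁ (cong sgn b₂) (+ x 0) (+ x 1) (+ x 2) eq)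
  where
  s₁ : sgn (b 1) ≡ - sgn (b 0)
  s₁ = trans (cong sgn b₁) (sgn-not (b 0))
  identity : ∀ s a c e → 0ℤ +ℤ (s *ℤ a +ℤ (- s) *ℤ c) +ℤ ((- s) *ℤ c +ℤ s *ℤ e) ≡ s *ℤ ((a +ℤ e) -ℤ (c +ℤ c))
  identity = solve-∀
  factor : ∀ s s₁ s₂ → s₁ ≡ - s → s₂ ≡ s → ∀ a c e →
    0ℤ +ℤ (s *ℤ a +ℤ s₁ *ℤ c) +ℤ (s₁ *ℤ c +ℤ s₂ *ℤ e) ≡ 0ℤ → s *ℤ ((a +ℤ e) -ℤ (c +ℤ c)) ≡ 0ℤ
  factor s _ _ refl refl a c e = trans (sym (identity s a c e))

cycleBalance : Bool → Bool → ℕ → ℕ → ℕ → ℕ → ℤ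
cycleBalance s₀ s₁ a b c d = sgn s₀ *ℤ (+ a -ℤ + d) +ℤ sgn s₁ *ℤ ((+ b +ℤ + b) -ℤ (+ c +ℤ + c))

drift₃≡0 : ∀ b x → b 2 ≡ not (b 1) → b 3 ≡ not (b 0) → drift (signed b x) 3 ≡ 0ℤ →
  cycleBalance (b 0) (b 1) (x 0) (x 1) (x 2) (x 3) ≡ 0ℤ
drift₃≡0 b x b₂ b₃ =
  factor (sgn (b 0)) (sgn (b 1)) (sgn (b 2)) (sgn (b 3)) (negated b₂) (negated b₃) (+ x 0) (+ x 1) (+ x 2) (+ x 3)
  where
  negated : ∀ {b′ b″} → b′ ≡ not b″ → sgn b′ ≡ - sgn b″
  negated {b″ = b″} eq = trans (cong sgn eq) (sgn-not b″)
  identity : ∀ s t a c e g →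
    0ℤ +ℤ (s *ℤ a +ℤ t *ℤ c) +ℤ (t *ℤ c +ℤ (- t) *ℤ e) +ℤ ((- t) *ℤ e +ℤ (- s) *ℤ g) ≡ s *ℤ (a -ℤ g) +ℤ t *ℤ ((c +ℤ c) -ℤ (e +ℤ e))
  identity = solve-∀
  factor : ∀ s t t′ s′ → t′ ≡ - t → s′ ≡ - s → ∀ a c e g →
    0ℤ +ℤ (s *ℤ a +ℤ t *ℤ c) +ℤ (t *ℤ c +ℤ t′ *ℤ e) +ℤ (t′ *ℤ e +ℤ s′ *ℤ g) ≡ 0ℤ →
    s *ℤ (a -ℤ g) +ℤ t *ℤ ((c +ℤ c) -ℤ (e +ℤ e)) ≡ 0ℤ
  factor s t _ _ refl refl a c e g = trans (sym (identity s t a c e g))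

cycleBalance-closed : ∀ s₀ s₁ a b c d → d ≡ a → cycleBalance s₀ s₁ a b c d ≡ 0ℤ → b + b ≡ c + c
cycleBalance-closed s₀ s₁ a b c .a refl eq =
  sgn-cancel-+ s₁ b b c c (trans (sym (identity (sgn s₀) (sgn s₁) (+ a) (+ b +ℤ + b) (+ c +ℤ + c))) eq)
  where
  identity : ∀ s t a u w → s *ℤ (a -ℤ a) +ℤ t *ℤ (u -ℤ w) ≡ t *ℤ (u -ℤ w)
  identity = solve-∀

cycleBalance-aligned-c≡a : ∀ s₀ s₁ a b c d → s₁ ≡ s₀ → c ≡ a → cycleBalance s₀ s₁ a b c d ≡ 0ℤ → b + b ≡ a + d
cycleBalance-aligned-c≡a s₀ .s₀ a b .a d refl refl eq =
  sgn-cancel-+ s₀ b b a d (trans (sym (identity (sgn s₀) (+ a) (+ b) (+ d))) eq)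
  where
  identity : ∀ s a b d → s *ℤ (a -ℤ d) +ℤ s *ℤ ((b +ℤ b) -ℤ (a +ℤ a)) ≡ s *ℤ ((b +ℤ b) -ℤ (a +ℤ d))
  identity = solve-∀

cycleBalance-aligned-d≡b : ∀ s₀ s₁ a b c d → s₁ ≡ s₀ → d ≡ b → cycleBalance s₀ s₁ a b c d ≡ 0ℤ → b + a ≡ c + c
cycleBalance-aligned-d≡b s₀ .s₀ a b c .b refl refl eq =
  sgn-cancel-+ s₀ b a c c (trans (sym (identity (sgn s₀) (+ a) (+ b) (+ c))) eq)
  where
  identity : ∀ s a b c → s *ℤ (a -ℤ b) +ℤ s *ℤ ((b +ℤ b) -ℤ (c +ℤ c)) ≡ s *ℤ ((b +ℤ a) -ℤ (c +ℤ c))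
  identity = solve-∀

∣signed∣ : ∀ b x j → ∣ signed b x j ∣ ≡ x j
∣signed∣ b x j with b j
... | false = trans (ℤ.abs-* 1ℤ (+ x j)) (*-identityˡ (x j))
... | true  = trans (ℤ.abs-* -1ℤ (+ x j)) (*-identityˡ (x j))

∣drift∣≤ : ∀ δ B → (∀ j → ∣ δ j ∣ ≤ B) → ∀ m → ∣ drift δ m ∣ ≤ m * (B + B)
∣drift∣≤ δ B δ≤B zero    = z≤n
∣drift∣≤ δ B δ≤B (suc m) = begin
  ∣ drift δ m +ℤ (δ m +ℤ δ (suc m)) ∣      ≤⟨ ℤ.∣i+j∣≤∣i∣+∣j∣ (drift δ m) _ ⟩
  ∣ drift δ m ∣ + ∣ δ m +ℤ δ (suc m) ∣     ≤⟨ +-mono-≤ (∣drift∣≤ δ B δ≤B m) (ℤ.∣i+j∣≤∣i∣+∣j∣ (δ m) _) ⟩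
  m * (B + B) + (∣ δ m ∣ + ∣ δ (suc m) ∣)  ≤⟨ +-monoʳ-≤ (m * (B + B)) (+-mono-≤ (δ≤B m) (δ≤B (suc m))) ⟩
  m * (B + B) + (B + B)                    ≡⟨ +-comm (m * (B + B)) (B + B) ⟩
  suc m * (B + B)                          ∎
  where open ≤-Reasoning

%-cancel : ∀ {M A B a b} .{{_ : NonZero M}} → A % M ≡ B % M → A + b ≡ B + a → a < M → b < M → a ≡ b
%-cancel {M} {A} {B} {a} {b} A≡B eq a<M b<M = sym (begin
  b                    ≡⟨ m<n⇒m%n≡m b<M ⟨
  b % M                ≡⟨ [m+kn]%n≡m%n b (A / M) M ⟨
  (b + A / M * M) % M  ≡⟨ cong (_% M) shifted ⟩
  (a + B / M * M) % M  ≡⟨ [m+kn]%n≡m%n a (B / M) M ⟩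
  a % M                ≡⟨ m<n⇒m%n≡m a<M ⟩
  a                    ∎)
  where
  open ≡-Reasoning
  split : A % M + (A / M * M + b) ≡ A % M + (B / M * M + a)
  split = begin
    A % M + (A / M * M + b)  ≡⟨ +-assoc (A % M) _ b ⟨
    A % M + A / M * M + b    ≡⟨ cong (_+ b) (m≡m%n+[m/n]*n A M) ⟨
    A + b                    ≡⟨ eq ⟩
    B + a                    ≡⟨ cong (_+ a) (m≡m%n+[m/n]*n B M) ⟩
    B % M + B / M * M + a    ≡⟨ cong (λ r → r + B / M * M + a) A≡B ⟨
    A % M + B / M * M + a    ≡⟨ +-assoc (A % M) _ a ⟩
    A % M + (B / M * M + a)  ∎
  shifted : b + A / M * M ≡ a + B / M * M
  shifted = trans (+-comm b _) (trans (+-cancelˡ-≡ (A % M) _ _ split) (+-comm _ a))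

%-cancel-ℤ : ∀ {M a b s} .{{_ : NonZero M}} → a % M ≡ b % M → + b ≡ + a +ℤ s → ∣ s ∣ < M → s ≡ 0ℤ
%-cancel-ℤ {M} {a} {b} {+ k} a≡b eq k<M =
  cong +_ (sym (%-cancel a≡b a+k≡b+0 (≤-trans (s≤s z≤n) k<M) k<M))
  where
  a+k≡b+0 : a + k ≡ b + 0
  a+k≡b+0 = trans (ℤ.+-injective (trans (ℤ.pos-+ a k) (sym eq))) (sym (+-identityʳ b))
%-cancel-ℤ {M} {a} {b} {ℤ.-[1+ k ]} a≡b eq k<M =
  ⊥-elim (1+n≢0 (%-cancel a≡b a+0≡b+k k<M (≤-trans (s≤s z≤n) k<M)))
  where
  cancel : ∀ a t → a +ℤ - t +ℤ t ≡ a
  cancel = solve-∀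
  a+0≡b+k : a + 0 ≡ b + suc k
  a+0≡b+k = ℤ.+-injective (begin
    + (a + 0)                     ≡⟨ cong +_ (+-identityʳ a) ⟩
    + a                           ≡⟨ cancel (+ a) (+ suc k) ⟨
    + a +ℤ ℤ.-[1+ k ] +ℤ + suc k  ≡⟨ cong (_+ℤ + suc k) eq ⟨
    + b +ℤ + suc k                ≡⟨ ℤ.pos-+ b (suc k) ⟨
    + (b + suc k)                 ∎)
    where open ≡-Reasoning

module Cycle {n} (C : C6Copy n) where

  at : ℕ → Fin 6
  at zero    = zero
  at (suc j) = next6 (at j)

  vertex : ℕ → Vertex n
  vertex j = w C (at j)

  dir : ℕ → Fin n
  dir j = d C (at j)

  bit : ℕ → Bool
  bit j = lookup (vertex j) (dir j)

  vertex-suc : ∀ j → vertex (suc j) ≡ flipAt (vertex j) (dir j)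
  vertex-suc j = steps C (at j)

  vertex-periodic : ∀ j → vertex (6 + j) ≡ vertex j
  vertex-periodic j = cong (w C) (period (at j))
    where
    period : ∀ a → next6 (next6 (next6 (next6 (next6 (next6 a))))) ≡ a
    period 0F = refl
    period 1F = refl
    period 2F = refl
    period 3F = refl
    period 4F = refl
    period 5F = refl

  dir-suc-≢ : ∀ j → dir (suc j) ≢ dir j
  dir-suc-≢ j eq = no-backtrack (at j) (w-inj C (begin
    vertex (2 + j)                              ≡⟨ vertex-suc (suc j) ⟩
    flipAt (vertex (suc j)) (dir (suc j))       ≡⟨ cong₂ flipAt (vertex-suc j) eq ⟩
    flipAt (flipAt (vertex j) (dir j)) (dir j)  ≡⟨ flipAt-involutive (vertex j) (dir j) ⟩
    vertex j                                    ∎))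
    where
    open ≡-Reasoning
    no-backtrack : ∀ a → next6 (next6 a) ≢ a
    no-backtrack 0F ()
    no-backtrack 1F ()
    no-backtrack 2F ()
    no-backtrack 3F ()
    no-backtrack 4F ()
    no-backtrack 5F ()

  lookup-suc-≢ : ∀ j {k} → k ≢ dir j → lookup (vertex (suc j)) k ≡ lookup (vertex j) k
  lookup-suc-≢ j {k} k≢ = trans (cong (λ u → lookup u k) (vertex-suc j)) (lookup-flipAt-≢ (vertex j) k≢)

  lookup-suc-≡ : ∀ j → lookup (vertex (suc j)) (dir j) ≡ not (bit j)
  lookup-suc-≡ j = trans (cong (λ u → lookup u (dir j)) (vertex-suc j)) (lookup-flipAt-≡ (vertex j) (dir j))

  bit-return : ∀ j → dir (2 + j) ≡ dir j → bit (2 + j) ≡ not (bit j)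
  bit-return j eq = begin
    lookup (vertex (2 + j)) (dir (2 + j))  ≡⟨ cong (lookup (vertex (2 + j))) eq ⟩
    lookup (vertex (2 + j)) (dir j)        ≡⟨ lookup-suc-≢ (suc j) (≢-sym (dir-suc-≢ j)) ⟩
    lookup (vertex (suc j)) (dir j)        ≡⟨ lookup-suc-≡ j ⟩
    not (bit j)                            ∎
    where open ≡-Reasoning

  closing-direction : ∀ r k → lookup (vertex (4 + r)) k ≡ not (lookup (vertex r) k) → k ≡ dir (4 + r) ⊎ k ≡ dir (5 + r)
  closing-direction r k flipped with k ≟ dir (4 + r) | k ≟ dir (5 + r)
  ... | yes k≡d₄ | _        = inj₁ k≡d₄
  ... | no _     | yes k≡d₅ = inj₂ k≡d₅
  ... | no k≢d₄  | no k≢d₅  = ⊥-elim (not-¬ unchanged flipped)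
    where
    unchanged : lookup (vertex (4 + r)) k ≡ lookup (vertex r) k
    unchanged = begin
      lookup (vertex (4 + r)) k  ≡⟨ lookup-suc-≢ (4 + r) k≢d₄ ⟨
      lookup (vertex (5 + r)) k  ≡⟨ lookup-suc-≢ (5 + r) k≢d₅ ⟨
      lookup (vertex (6 + r)) k  ≡⟨ cong (λ u → lookup u k) (vertex-periodic r) ⟩
      lookup (vertex r) k        ∎
      where open ≡-Reasoning

  -- The vertex at position 4 differs from the start in the three distinct coordinates d₀, d₁, d₂,
  -- but only the two closing directions lead back to the start.
  four-distinct-directions⇒⊥ : ∀ r → dir (2 + r) ≢ dir r → dir (3 + r) ≢ dir (1 + r) → dir (3 + r) ≢ dir r → ⊥
  four-distinct-directions⇒⊥ r d₂≢d₀ d₃≢d₁ d₃≢d₀ =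
    pigeonhole (closing-direction r (dir r) flipped₀) (closing-direction r (dir (1 + r)) flipped₁)
               (closing-direction r (dir (2 + r)) flipped₂)
    where
    v : ℕ → Vertex n
    v j = vertex (j + r)
    d₀≢d₁ : dir r ≢ dir (1 + r)
    d₀≢d₁ = ≢-sym (dir-suc-≢ r)
    d₁≢d₂ : dir (1 + r) ≢ dir (2 + r)
    d₁≢d₂ = ≢-sym (dir-suc-≢ (1 + r))
    flipped₀ : lookup (v 4) (dir r) ≡ not (lookup (v 0) (dir r))
    flipped₀ = begin
      lookup (v 4) (dir r)  ≡⟨ lookup-suc-≢ (3 + r) (≢-sym d₃≢d₀) ⟩
      lookup (v 3) (dir r)  ≡⟨ lookup-suc-≢ (2 + r) (≢-sym d₂≢d₀) ⟩
      lookup (v 2) (dir r)  ≡⟨ lookup-suc-≢ (1 + r) d₀≢d₁ ⟩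
      lookup (v 1) (dir r)  ≡⟨ lookup-suc-≡ r ⟩
      not (bit r)           ∎
      where open ≡-Reasoning
    flipped₁ : lookup (v 4) (dir (1 + r)) ≡ not (lookup (v 0) (dir (1 + r)))
    flipped₁ = begin
      lookup (v 4) (dir (1 + r))        ≡⟨ lookup-suc-≢ (3 + r) (≢-sym d₃≢d₁) ⟩
      lookup (v 3) (dir (1 + r))        ≡⟨ lookup-suc-≢ (2 + r) d₁≢d₂ ⟩
      lookup (v 2) (dir (1 + r))        ≡⟨ lookup-suc-≡ (1 + r) ⟩
      not (lookup (v 1) (dir (1 + r)))  ≡⟨ cong not (lookup-suc-≢ r (dir-suc-≢ r)) ⟩
      not (lookup (v 0) (dir (1 + r)))  ∎
      where open ≡-Reasoning
    flipped₂ : lookup (v 4) (dir (2 + r)) ≡ not (lookup (v 0) (dir (2 + r)))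
    flipped₂ = begin
      lookup (v 4) (dir (2 + r))        ≡⟨ lookup-suc-≢ (3 + r) (≢-sym (dir-suc-≢ (2 + r))) ⟩
      lookup (v 3) (dir (2 + r))        ≡⟨ lookup-suc-≡ (2 + r) ⟩
      not (lookup (v 2) (dir (2 + r)))  ≡⟨ cong not (lookup-suc-≢ (1 + r) (dir-suc-≢ (1 + r))) ⟩
      not (lookup (v 1) (dir (2 + r)))  ≡⟨ cong not (lookup-suc-≢ r d₂≢d₀) ⟩
      not (lookup (v 0) (dir (2 + r)))  ∎
      where open ≡-Reasoning
    pigeonhole : dir r ≡ dir (4 + r) ⊎ dir r ≡ dir (5 + r) →
                 dir (1 + r) ≡ dir (4 + r) ⊎ dir (1 + r) ≡ dir (5 + r) →
                 dir (2 + r) ≡ dir (4 + r) ⊎ dir (2 + r) ≡ dir (5 + r) → ⊥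
    pigeonhole (inj₁ p) (inj₁ q) _        = d₀≢d₁ (trans p (sym q))
    pigeonhole (inj₂ p) (inj₂ q) _        = d₀≢d₁ (trans p (sym q))
    pigeonhole _        (inj₁ q) (inj₁ s) = d₁≢d₂ (trans q (sym s))
    pigeonhole _        (inj₂ q) (inj₂ s) = d₁≢d₂ (trans q (sym s))
    pigeonhole (inj₁ p) (inj₂ _) (inj₁ s) = d₂≢d₀ (trans s (sym p))
    pigeonhole (inj₂ p) (inj₁ _) (inj₂ s) = d₂≢d₀ (trans s (sym p))

  repeated-direction : ∀ r → dir (2 + r) ≡ dir r ⊎ dir (3 + r) ≡ dir (1 + r) ⊎ dir (3 + r) ≡ dir r
  repeated-direction r with dir (2 + r) ≟ dir r | dir (3 + r) ≟ dir (1 + r) | dir (3 + r) ≟ dir r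
  ... | yes d₂≡d₀ | _         | _         = inj₁ d₂≡d₀
  ... | no _      | yes d₃≡d₁ | _         = inj₂ (inj₁ d₃≡d₁)
  ... | no _      | no _      | yes d₃≡d₀ = inj₂ (inj₂ d₃≡d₀)
  ... | no d₂≢d₀  | no d₃≢d₁  | no d₃≢d₀  = ⊥-elim (four-distinct-directions⇒⊥ r d₂≢d₀ d₃≢d₁ d₃≢d₀)

  edgeValue : (Fin n → ℕ) → ℕ → ℕ
  edgeValue X j = edgeWeight X (vertex j) (dir j)

  bits : ℕ → ℕ → Bool
  bits r j = bit (j + r)

  weights : (Fin n → ℕ) → ℕ → ℕ → ℕ
  weights X r j = X (dir (j + r))

  potential : (Fin n → ℕ) → ℕ → ℤ
  potential X j = + weight X (vertex j)

  step : (Fin n → ℕ) → ℕ → ℤ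
  step X = signed bit (λ j → X (dir j))

  potential-suc : ∀ X j → potential X (suc j) ≡ potential X j +ℤ step X j
  potential-suc X j = trans (cong (+_ ∘ weight X) (vertex-suc j)) (weight-flipAt X (vertex j) (dir j))

  edgeValue-potential : ∀ X j → + edgeValue X j ≡ potential X j +ℤ potential X (suc j)
  edgeValue-potential X j =
    trans (ℤ.pos-+ (weight X (vertex j)) _) (cong (λ u → potential X j +ℤ + weight X u) (sym (vertex-suc j)))

  edgeValue-suc : ∀ X j → + edgeValue X (suc j) ≡ + edgeValue X j +ℤ (step X j +ℤ step X (suc j))
  edgeValue-suc X j = begin
    + edgeValue X (suc j)                   ≡⟨ edgeValue-potential X (suc j) ⟩
    P (suc j) +ℤ P (2 + j)                  ≡⟨ two-steps (P j) (δ j) (δ (suc j)) (potential-suc X j) (potential-suc X (suc j)) ⟩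
    P j +ℤ P (suc j) +ℤ (δ j +ℤ δ (suc j))  ≡⟨ cong (_+ℤ (δ j +ℤ δ (suc j))) (edgeValue-potential X j) ⟨
    + edgeValue X j +ℤ (δ j +ℤ δ (suc j))   ∎
    where
    open ≡-Reasoning
    P δ : ℕ → ℤ
    P = potential X
    δ = step X
    identity : ∀ p a b → (p +ℤ a) +ℤ (p +ℤ a +ℤ b) ≡ p +ℤ (p +ℤ a) +ℤ (a +ℤ b)
    identity = solve-∀
    two-steps : ∀ p₀ a b {p₁ p₂} → p₁ ≡ p₀ +ℤ a → p₂ ≡ p₁ +ℤ b → p₁ +ℤ p₂ ≡ p₀ +ℤ p₁ +ℤ (a +ℤ b)
    two-steps p₀ a b refl refl = identity p₀ a b

  edgeValue-telescope : ∀ X r m → + edgeValue X (m + r) ≡ + edgeValue X r +ℤ drift (signed (bits r) (weights X r)) m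
  edgeValue-telescope X r zero    = sym (ℤ.+-identityʳ _)
  edgeValue-telescope X r (suc m) = begin
    + edgeValue X (suc m + r)           ≡⟨ edgeValue-suc X (m + r) ⟩
    + edgeValue X (m + r) +ℤ Δ          ≡⟨ cong (_+ℤ Δ) (edgeValue-telescope X r m) ⟩
    + edgeValue X r +ℤ drift δ m +ℤ Δ   ≡⟨ ℤ.+-assoc (+ edgeValue X r) (drift δ m) Δ ⟩
    + edgeValue X r +ℤ drift δ (suc m)  ∎
    where
    open ≡-Reasoning
    δ : ℕ → ℤ
    δ = signed (bits r) (weights X r)
    Δ : ℤ
    Δ = δ m +ℤ δ (suc m)

  drift≡0 : ∀ X B → (∀ k → X k ≤ B) → ∀ r m → m ≤ 3 →
    edgeValue X r % (6 * suc B) ≡ edgeValue X (m + r) % (6 * suc B) →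
    drift (signed (bits r) (weights X r)) m ≡ 0ℤ
  drift≡0 X B X≤B r m m≤3 eq = %-cancel-ℤ eq (edgeValue-telescope X r m) (begin-strict
    ∣ drift (signed (bits r) (weights X r)) m ∣  ≤⟨ ∣drift∣≤ _ B step≤B m ⟩
    m * (B + B)                                  ≤⟨ *-monoˡ-≤ (B + B) m≤3 ⟩
    3 * (B + B)                                  <⟨ m<n+m (3 * (B + B)) {6} (s≤s z≤n) ⟩
    6 + 3 * (B + B)                              ≡⟨ six B ⟩
    6 * suc B                                    ∎)
    where
    open ≤-Reasoning
    step≤B : ∀ j → ∣ signed (bits r) (weights X r) j ∣ ≤ B
    step≤B j = ≤-trans (≤-reflexive (∣signed∣ (bits r) (weights X r) j)) (X≤B (dir (j + r)))
    six : ∀ B → 6 + 3 * (B + B) ≡ 6 * suc B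
    six = ℕ-Solver.solve-∀

mod-injective : ∀ a b {M} .{{_ : NonZero M}} → a mod M ≡ b mod M → a % M ≡ b % M
mod-injective a b {M} eq =
  trans (sym (toℕ-fromℕ< (m%n<n a M))) (trans (cong toℕ eq) (toℕ-fromℕ< (m%n<n b M)))

module Residues {n m : ℕ} (X : Fin m → Fin n → ℕ) (B : Fin m → ℕ) where

  unit : Fin n → ℕ
  unit _ = 1

  modulus : Fin m → ℕ
  modulus c = 6 * suc (B c)

  unitResidue : Vertex n → Fin n → Fin 12
  unitResidue v i = edgeWeight unit v i mod 12

  residue : (c : Fin m) → Vertex n → Fin n → Fin (modulus c)
  residue c v i = edgeWeight (X c) v i mod modulus c

  SameResidues : Vertex n → Fin n → Vertex n → Fin n → Set
  SameResidues v i v′ i′ = unitResidue v i ≡ unitResidue v′ i′ × (∀ c → residue c v i ≡ residue c v′ i′)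

  same-residues-sym : ∀ {v i v′ i′} → SameResidues v i v′ i′ → SameResidues v′ i′ v i
  same-residues-sym (u , x) = sym u , λ c → sym (x c)

  Separating : Set
  Separating = ∀ p q r → (∀ c → X c p + X c q ≡ X c r + X c r) → p ≡ r

  module _ (X≤B : ∀ c k → X c k ≤ B c) (separating : Separating) (C : C6Copy n) where
    open Cycle C

    Agree : ℕ → ℕ → Set
    Agree r s = SameResidues (vertex r) (dir r) (vertex s) (dir s)

    agree-sym : ∀ r s → Agree r s → Agree s r
    agree-sym r s = same-residues-sym {vertex r} {dir r} {vertex s} {dir s}

    unit-drift≡0 : ∀ r m → m ≤ 3 → Agree r (m + r) → drift (signed (bits r) (weights unit r)) m ≡ 0ℤ
    unit-drift≡0 r m m≤3 (u , _) =
      drift≡0 unit 1 (λ _ → ≤-refl) r m m≤3 (mod-injective (edgeValue unit r) (edgeValue unit (m + r)) u)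

    weight-drift≡0 : ∀ r m → m ≤ 3 → Agree r (m + r) → ∀ c → drift (signed (bits r) (weights (X c) r)) m ≡ 0ℤ
    weight-drift≡0 r m m≤3 (_ , x) c =
      drift≡0 (X c) (B c) (X≤B c) r m m≤3 (mod-injective (edgeValue (X c) r) (edgeValue (X c) (m + r)) (x c))

    apart₁ : ∀ r → ¬ Agree r (1 + r)
    apart₁ r agree = dir-suc-≢ r (sym (separating (dir r) (dir r) (dir (1 + r)) λ c →
      cong (λ y → y + y) (drift₁≡0 (bits r) (weights (X c) r) b₁ (weight-drift≡0 r 1 1≤3 agree c))))
      where
      1≤3 : 1 ≤ 3
      1≤3 = s≤s z≤n
      b₁ : bit (1 + r) ≡ not (bit r)
      b₁ = balanced₁ (bits r) (unit-drift≡0 r 1 1≤3 agree)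

    apart₂ : ∀ r → ¬ Agree r (2 + r)
    apart₂ r agree = dir-suc-≢ r (sym (separating (dir r) (dir (2 + r)) (dir (1 + r)) λ c →
      drift₂≡0 (bits r) (weights (X c) r) (proj₁ signs) (proj₂ signs) (weight-drift≡0 r 2 2≤3 agree c)))
      where
      2≤3 : 2 ≤ 3
      2≤3 = s≤s (s≤s z≤n)
      signs : bit (1 + r) ≡ not (bit r) × bit (2 + r) ≡ bit r
      signs = balanced₂ (bits r) (unit-drift≡0 r 2 2≤3 agree)

    apart₃ : ∀ r → ¬ Agree r (3 + r)
    apart₃ r agree = from-repeat (repeated-direction r)
      where
      signs : bit (2 + r) ≡ not (bit (1 + r)) × bit (3 + r) ≡ not (bit r)
      signs = balanced₃ (bits r) (unit-drift≡0 r 3 ≤-refl agree)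
      x : Fin m → ℕ → ℕ
      x c = weights (X c) r
      balance : ∀ c → cycleBalance (bit r) (bit (1 + r)) (x c 0) (x c 1) (x c 2) (x c 3) ≡ 0ℤ
      balance c = drift₃≡0 (bits r) (weights (X c) r) (proj₁ signs) (proj₂ signs) (weight-drift≡0 r 3 ≤-refl agree c)
      from-repeat : dir (2 + r) ≡ dir r ⊎ dir (3 + r) ≡ dir (1 + r) ⊎ dir (3 + r) ≡ dir r → ⊥
      from-repeat (inj₁ d₂≡d₀) = dir-suc-≢ r (sym (separating (dir r) (dir (3 + r)) (dir (1 + r)) λ c →
        sym (cycleBalance-aligned-c≡a (bit r) (bit (1 + r)) (x c 0) (x c 1) (x c 2) (x c 3) b₁≡b₀ (cong (X c) d₂≡d₀) (balance c))))
        where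
        b₁≡b₀ : bit (1 + r) ≡ bit r
        b₁≡b₀ = not-injective (trans (sym (proj₁ signs)) (bit-return r d₂≡d₀))
      from-repeat (inj₂ (inj₁ d₃≡d₁)) = dir-suc-≢ (1 + r) (sym (separating (dir (1 + r)) (dir r) (dir (2 + r)) λ c →
        cycleBalance-aligned-d≡b (bit r) (bit (1 + r)) (x c 0) (x c 1) (x c 2) (x c 3) b₁≡b₀ (cong (X c) d₃≡d₁) (balance c)))
        where
        b₁≡b₀ : bit (1 + r) ≡ bit r
        b₁≡b₀ = not-injective (trans (sym (bit-return (1 + r) d₃≡d₁)) (proj₂ signs))
      from-repeat (inj₂ (inj₂ d₃≡d₀)) = dir-suc-≢ (1 + r) (sym (separating (dir (1 + r)) (dir (1 + r)) (dir (2 + r)) λ c →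
        cycleBalance-closed (bit r) (bit (1 + r)) (x c 0) (x c 1) (x c 2) (x c 3) (cong (X c) d₃≡d₀) (balance c)))

    -- Positions are read modulo 6, so of two distinct edges one is 1, 2 or 3 steps after the other.
    residues-distinct : ∀ {i j} → SameResidues (w C i) (d C i) (w C j) (d C j) → i ≡ j
    residues-distinct {0F} {0F} _  = refl
    residues-distinct {0F} {1F} eq = ⊥-elim (apart₁ 0 eq)
    residues-distinct {0F} {2F} eq = ⊥-elim (apart₂ 0 eq)
    residues-distinct {0F} {3F} eq = ⊥-elim (apart₃ 0 eq)
    residues-distinct {0F} {4F} eq = ⊥-elim (apart₂ 4 (agree-sym 6 4 eq))
    residues-distinct {0F} {5F} eq = ⊥-elim (apart₁ 5 (agree-sym 6 5 eq))
    residues-distinct {1F} {0F} eq = ⊥-elim (apart₁ 0 (agree-sym 1 0 eq))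
    residues-distinct {1F} {1F} _  = refl
    residues-distinct {1F} {2F} eq = ⊥-elim (apart₁ 1 eq)
    residues-distinct {1F} {3F} eq = ⊥-elim (apart₂ 1 eq)
    residues-distinct {1F} {4F} eq = ⊥-elim (apart₃ 1 eq)
    residues-distinct {1F} {5F} eq = ⊥-elim (apart₂ 5 (agree-sym 7 5 eq))
    residues-distinct {2F} {0F} eq = ⊥-elim (apart₂ 0 (agree-sym 2 0 eq))
    residues-distinct {2F} {1F} eq = ⊥-elim (apart₁ 1 (agree-sym 2 1 eq))
    residues-distinct {2F} {2F} _  = refl
    residues-distinct {2F} {3F} eq = ⊥-elim (apart₁ 2 eq)
    residues-distinct {2F} {4F} eq = ⊥-elim (apart₂ 2 eq)
    residues-distinct {2F} {5F} eq = ⊥-elim (apart₃ 2 eq)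
    residues-distinct {3F} {0F} eq = ⊥-elim (apart₃ 3 eq)
    residues-distinct {3F} {1F} eq = ⊥-elim (apart₂ 1 (agree-sym 3 1 eq))
    residues-distinct {3F} {2F} eq = ⊥-elim (apart₁ 2 (agree-sym 3 2 eq))
    residues-distinct {3F} {3F} _  = refl
    residues-distinct {3F} {4F} eq = ⊥-elim (apart₁ 3 eq)
    residues-distinct {3F} {5F} eq = ⊥-elim (apart₂ 3 eq)
    residues-distinct {4F} {0F} eq = ⊥-elim (apart₂ 4 eq)
    residues-distinct {4F} {1F} eq = ⊥-elim (apart₃ 4 eq)
    residues-distinct {4F} {2F} eq = ⊥-elim (apart₂ 2 (agree-sym 4 2 eq))
    residues-distinct {4F} {3F} eq = ⊥-elim (apart₁ 3 (agree-sym 4 3 eq))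
    residues-distinct {4F} {4F} _  = refl
    residues-distinct {4F} {5F} eq = ⊥-elim (apart₁ 4 eq)
    residues-distinct {5F} {0F} eq = ⊥-elim (apart₁ 5 eq)
    residues-distinct {5F} {1F} eq = ⊥-elim (apart₂ 5 eq)
    residues-distinct {5F} {2F} eq = ⊥-elim (apart₃ 5 eq)
    residues-distinct {5F} {3F} eq = ⊥-elim (apart₂ 3 (agree-sym 5 3 eq))
    residues-distinct {5F} {4F} eq = ⊥-elim (apart₁ 4 (agree-sym 5 4 eq))
    residues-distinct {5F} {5F} _  = refl

-- Behrend's weights

parallelogram-≤ : ∀ {u v} → u ≤ v → (u * u + v * v) + (u * u + v * v) ≡ (u + v) * (u + v) + ∣ u - v ∣ℕ * ∣ u - v ∣ℕ
parallelogram-≤ {u} u≤v with k , refl ← m≤n⇒∃[o]m+o≡n u≤v rewrite ∣m-m+n∣≡n u k = identity u k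
  where
  identity : ∀ u k → (u * u + (u + k) * (u + k)) + (u * u + (u + k) * (u + k)) ≡ (u + (u + k)) * (u + (u + k)) + k * k
  identity = ℕ-Solver.solve-∀

parallelogram : ∀ u v → (u * u + v * v) + (u * u + v * v) ≡ (u + v) * (u + v) + ∣ u - v ∣ℕ * ∣ u - v ∣ℕ
parallelogram u v with ≤-total u v
... | inj₁ u≤v = parallelogram-≤ u≤v
... | inj₂ v≤u = begin
  (u * u + v * v) + (u * u + v * v)            ≡⟨ cong (λ z → z + z) (+-comm (u * u) (v * v)) ⟩
  (v * v + u * u) + (v * v + u * u)            ≡⟨ parallelogram-≤ v≤u ⟩
  (v + u) * (v + u) + ∣ v - u ∣ℕ * ∣ v - u ∣ℕ  ≡⟨ cong₂ (λ s t → s * s + t * t) (+-comm v u) (∣-∣-comm v u) ⟩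
  (u + v) * (u + v) + ∣ u - v ∣ℕ * ∣ u - v ∣ℕ  ∎
  where open ≡-Reasoning

≤-sum : ∀ {L} (f : Fin L → ℕ) t → f t ≤ sum f
≤-sum f zero    = m≤m+n (f zero) _
≤-sum f (suc t) = ≤-trans (≤-sum (f ∘ suc) t) (m≤n+m _ (f zero))

sum-≤ : ∀ {L} (f : Fin L → ℕ) {B} → (∀ t → f t ≤ B) → sum f ≤ L * B
sum-≤ {zero}  f f≤B = z≤n
sum-≤ {suc L} f f≤B = +-mono-≤ (f≤B zero) (sum-≤ (f ∘ suc) (f≤B ∘ suc))

squares-detect-midpoints : ∀ {L} (a b c : Fin L → ℕ) → (∀ t → a t + b t ≡ c t + c t) →
  sum (λ t → a t * a t) + sum (λ t → b t * b t) ≡ sum (λ t → c t * c t) + sum (λ t → c t * c t) →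
  ∀ t → a t ≡ c t
squares-detect-midpoints {L} a b c midpoint squares t = halve (trans (cong (λ z → a t + z) a≡b) (midpoint t))
  where
  open ≡-Reasoning
  A B C Δ : Fin L → ℕ
  A s = a s * a s
  B s = b s * b s
  C s = c s * c s
  Δ s = ∣ a s - b s ∣ℕ * ∣ a s - b s ∣ℕ
  Q : ℕ
  Q = (sum C + sum C) + (sum C + sum C)
  quadruple : ∀ x → (x + x) * (x + x) ≡ (x * x + x * x) + (x * x + x * x)
  quadruple = ℕ-Solver.solve-∀
  pointwise : ∀ s → (A s + B s) + (A s + B s) ≡ ((C s + C s) + (C s + C s)) + Δ s
  pointwise s = trans (parallelogram (a s) (b s))
    (cong (_+ Δ s) (trans (cong (λ z → z * z) (midpoint s)) (quadruple (c s))))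
  sum-double : ∀ (f : Fin L → ℕ) → sum (λ s → f s + f s) ≡ sum f + sum f
  sum-double f = ∑-distrib-+ f f
  ΣΔ≡0 : sum Δ ≡ 0
  ΣΔ≡0 = +-cancelˡ-≡ Q _ _ (begin
    Q + sum Δ                                              ≡⟨ cong (λ z → z + z + sum Δ) (sum-double C) ⟨
    sum (λ s → C s + C s) + sum (λ s → C s + C s) + sum Δ  ≡⟨ cong (_+ sum Δ) (sum-double (λ s → C s + C s)) ⟨
    sum (λ s → (C s + C s) + (C s + C s)) + sum Δ          ≡⟨ ∑-distrib-+ (λ s → (C s + C s) + (C s + C s)) Δ ⟨
    sum (λ s → ((C s + C s) + (C s + C s)) + Δ s)          ≡⟨ sum-cong-≗ pointwise ⟨
    sum (λ s → (A s + B s) + (A s + B s))                  ≡⟨ sum-double (λ s → A s + B s) ⟩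
    sum (λ s → A s + B s) + sum (λ s → A s + B s)          ≡⟨ cong (λ z → z + z) (∑-distrib-+ A B) ⟩
    (sum A + sum B) + (sum A + sum B)                      ≡⟨ cong (λ z → z + z) squares ⟩
    Q                                                      ≡⟨ +-identityʳ Q ⟨
    Q + 0                                                  ∎)
  a≡b : a t ≡ b t
  a≡b = ∣m-n∣≡0⇒m≡n (reduce (m*n≡0⇒m≡0∨n≡0 ∣ a t - b t ∣ℕ (n≤0⇒n≡0 (≤-trans (≤-sum Δ t) (≤-reflexive ΣΔ≡0)))))
  halve : ∀ {x y} → x + x ≡ y + y → x ≡ y
  halve {x} {y} eq =
    *-cancelˡ-≡ x y 2 (trans (cong (λ z → x + z) (+-identityʳ x)) (trans eq (cong (λ z → y + z) (sym (+-identityʳ y)))))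

funToFin-cong : ∀ {m k} {f g : Fin m → Fin k} → (∀ t → f t ≡ g t) → funToFin f ≡ funToFin g
funToFin-cong {zero}  f≗g = refl
funToFin-cong {suc m} f≗g = cong₂ combine (f≗g zero) (funToFin-cong (f≗g ∘ suc))

funToFin-injective : ∀ {m k} {f g : Fin m → Fin k} → funToFin f ≡ funToFin g → ∀ t → f t ≡ g t
funToFin-injective {f = f} {g} eq t =
  trans (sym (finToFun-funToFin f t)) (trans (cong (λ i → finToFun i t) eq) (finToFun-funToFin g t))

finToFun-injective : ∀ {m k} {i j : Fin (k ^ m)} → (∀ t → finToFun {k} {m} i t ≡ finToFun j t) → i ≡ j
finToFun-injective {m} {k} {i} {j} eq =
  trans (sym (funToFin-finToFin {m} {k} i))
        (trans (funToFin-cong {f = finToFun {k} {m} i} {finToFun j} eq) (funToFin-finToFin {m} {k} j))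

-- Residues of the Hamming weight, of the sum of squared digits, and of each of the L digits.
colourCount : ℕ → ℕ → ℕ
colourCount e L = 12 * (6 * suc (L * (e * e)) * (6 * suc e) ^ L)

module Behrend (e L n : ℕ) (n≤ : n ≤ suc e ^ L) where

  digits : Fin n → Fin L → Fin (suc e)
  digits k = finToFun {suc e} {L} (inject≤ k n≤)

  digit : Fin L → Fin n → ℕ
  digit t k = toℕ (digits k t)

  squareSum : Fin n → ℕ
  squareSum k = sum (λ t → digit t k * digit t k)

  family : Fin (suc L) → Fin n → ℕ
  family zero    = squareSum
  family (suc t) = digit t

  bound : Fin (suc L) → ℕ
  bound zero    = L * (e * e)
  bound (suc t) = e

  family≤bound : ∀ c k → family c k ≤ bound c
  family≤bound zero    k = sum-≤ _ λ t → *-mono-≤ (digit≤e t) (digit≤e t)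
    where
    digit≤e : ∀ t → digit t k ≤ e
    digit≤e t = toℕ≤pred[n] (digits k t)
  family≤bound (suc t) k = toℕ≤pred[n] (digits k t)

  open Residues family bound

  family-separating : Separating
  family-separating p q r midpoint =
    toℕ-injective (trans (sym (toℕ-inject≤ p n≤)) (trans (cong toℕ same-digits) (toℕ-inject≤ r n≤)))
    where
    same-digits : inject≤ p n≤ ≡ inject≤ r n≤
    same-digits = finToFun-injective {L} {suc e} λ t → toℕ-injective
      (squares-detect-midpoints (λ t → digit t p) (λ t → digit t q) (λ t → digit t r)
                                (midpoint ∘ suc) (midpoint zero) t)

  colour : Vertex n → Fin n → Fin (colourCount e L)
  colour v i = combine (unitResidue v i) (combine (residue zero v i) (funToFin λ t → residue (suc t) v i))

  colouring : EdgeColoring n (colourCount e L)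
  colouring = record { color = colour ; wellDefined = well-defined }
    where
    well-defined : ∀ v i → colour v i ≡ colour (flipAt v i) i
    well-defined v i =
      sym (cong₂ combine (same unit) (cong₂ combine (same squareSum) (funToFin-cong λ t → same (digit t))))
      where
      same : ∀ {M} .{{_ : NonZero M}} X → edgeWeight X (flipAt v i) i mod M ≡ edgeWeight X v i mod M
      same X = cong (_mod _) (edgeWeight-flipAt X v i)

  colour-residues : ∀ v i v′ i′ → colour v i ≡ colour v′ i′ → SameResidues v i v′ i′
  colour-residues v i v′ i′ eq with combine-injective _ _ _ _ eq
  ... | unit≡ , rest with combine-injective _ _ _ _ rest
  ... | square≡ , digits≡ = unit≡ , λ where
    zero    → square≡
    (suc t) → funToFin-injective digits≡ t

  colouring-rainbow : C6Rainbow colouring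
  colouring-rainbow C {i} {j} =
    residues-distinct family≤bound family-separating C ∘ colour-residues (w C i) (d C i) (w C j) (d C j)

-- Counting colours

^-distribʳ-* : ∀ m n k → (m * n) ^ k ≡ m ^ k * n ^ k
^-distribʳ-* m n zero    = refl
^-distribʳ-* m n (suc k) = trans (cong (m * n *_) (^-distribʳ-* m n k)) (interchange m n (m ^ k) (n ^ k))
  where
  interchange : ∀ a b c d → a * b * (c * d) ≡ a * c * (b * d)
  interchange = ℕ-Solver.solve-∀

^-reflectsˡ-< : ∀ {a b} k → a ^ k < b ^ k → a < b
^-reflectsˡ-< {a} {b} k a^k<b^k with a <? b
... | yes a<b = a<b
... | no  a≮b = ⊥-elim (<⇒≱ a^k<b^k (^-monoˡ-≤ k (≮⇒≥ a≮b)))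

integer-root : ∀ L n → ∃[ e ] (e ^ suc L ≤ n × n < suc e ^ suc L)
integer-root L zero    = 0 , z≤n , subst (0 <_) (sym (^-zeroˡ (suc L))) (s≤s z≤n)
integer-root L (suc n) with integer-root L n
... | e , e^L≤n , n<[1+e]^L with suc n <? suc e ^ suc L
...   | yes n+1<[1+e]^L = e , m≤n⇒m≤1+n e^L≤n , n+1<[1+e]^L
...   | no  n+1≮[1+e]^L = suc e , ≤-reflexive tight , subst (_< suc (suc e) ^ suc L) tight (^-monoˡ-< (suc L) (n<1+n (suc e)))
  where
  tight : suc e ^ suc L ≡ suc n
  tight = ≤-antisym (≮⇒≥ n+1≮[1+e]^L) n<[1+e]^L

6[1+x]≤12x : ∀ {x} → 1 ≤ x → 6 * suc x ≤ 12 * x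
6[1+x]≤12x {x} 1≤x = begin
  6 * suc x      ≡⟨ split x ⟩
  6 + 6 * x      ≤⟨ +-monoˡ-≤ (6 * x) (*-monoʳ-≤ 6 1≤x) ⟩
  6 * x + 6 * x  ≡⟨ double x ⟩
  12 * x         ∎
  where
  open ≤-Reasoning
  split : ∀ x → 6 * suc x ≡ 6 + 6 * x
  split = ℕ-Solver.solve-∀
  double : ∀ x → 6 * x + 6 * x ≡ 12 * x
  double = ℕ-Solver.solve-∀

colourCount≤ : ∀ e L → 1 ≤ e → 1 ≤ L → colourCount e L ≤ 144 * L * 12 ^ L * e ^ (L + 2)
colourCount≤ e L 1≤e 1≤L = begin
  12 * (6 * suc (L * (e * e)) * (6 * suc e) ^ L)  ≤⟨ *-monoʳ-≤ 12 (*-mono-≤ (6[1+x]≤12x 1≤Le²) (^-monoˡ-≤ L 6[1+e]≤12e)) ⟩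
  12 * (12 * (L * (e * e)) * (12 * e) ^ L)        ≡⟨ cong (λ z → 12 * (12 * (L * (e * e)) * z)) (^-distribʳ-* 12 e L) ⟩
  12 * (12 * (L * (e * e)) * (12 ^ L * e ^ L))    ≡⟨ regroup L e (12 ^ L) (e ^ L) ⟩
  144 * L * 12 ^ L * (e ^ L * (e * e))            ≡⟨ cong (λ z → 144 * L * 12 ^ L * (e ^ L * z)) (cong (e *_) (*-identityʳ e)) ⟨
  144 * L * 12 ^ L * (e ^ L * e ^ 2)              ≡⟨ cong (144 * L * 12 ^ L *_) (^-distribˡ-+-* e L 2) ⟨
  144 * L * 12 ^ L * e ^ (L + 2)                  ∎
  where
  open ≤-Reasoning
  1≤Le² : 1 ≤ L * (e * e)
  1≤Le² = *-mono-≤ 1≤L (*-mono-≤ 1≤e 1≤e)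
  6[1+e]≤12e : 6 * suc e ≤ 12 * e
  6[1+e]≤12e = 6[1+x]≤12x 1≤e
  regroup : ∀ L e a b → 12 * (12 * (L * (e * e)) * (a * b)) ≡ 144 * L * a * (b * (e * e))
  regroup = ℕ-Solver.solve-∀

colourCount^q≤ : ∀ {e n} L p q → 1 ≤ e → 1 ≤ L → e ^ L ≤ n → (144 * L * 12 ^ L) ^ q ≤ e →
  suc ((L + 2) * q) ≤ L * (q + p) → colourCount e L ^ q ≤ n ^ (q + p)
colourCount^q≤ {e} {n} L p q 1≤e 1≤L e^L≤n C^q≤e exponent = begin
  colourCount e L ^ q        ≤⟨ ^-monoˡ-≤ q (colourCount≤ e L 1≤e 1≤L) ⟩
  (C * e ^ (L + 2)) ^ q      ≡⟨ ^-distribʳ-* C (e ^ (L + 2)) q ⟩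
  C ^ q * (e ^ (L + 2)) ^ q  ≤⟨ *-monoˡ-≤ ((e ^ (L + 2)) ^ q) C^q≤e ⟩
  e * (e ^ (L + 2)) ^ q      ≡⟨ cong (e *_) (^-*-assoc e (L + 2) q) ⟩
  e ^ suc ((L + 2) * q)      ≤⟨ ^-monoʳ-≤ e {{>-nonZero 1≤e}} exponent ⟩
  e ^ (L * (q + p))          ≡⟨ ^-*-assoc e L (q + p) ⟨
  (e ^ L) ^ (q + p)          ≤⟨ ^-monoˡ-≤ (q + p) e^L≤n ⟩
  n ^ (q + p)                ∎
  where
  open ≤-Reasoning
  C : ℕ
  C = 144 * L * 12 ^ L

exponent-gap : ∀ p′ q → suc ((suc (q + q) + 2) * q) ≤ suc (q + q) * (q + suc p′)
exponent-gap p′ q = begin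
  suc ((suc (q + q) + 2) * q)  ≡⟨ expand q ⟩
  L * q + L                    ≤⟨ +-monoʳ-≤ (L * q) (m≤m*n L (suc p′)) ⟩
  L * q + L * suc p′           ≡⟨ *-distribˡ-+ L q (suc p′) ⟨
  L * (q + suc p′)             ∎
  where
  open ≤-Reasoning
  L : ℕ
  L = suc (q + q)
  expand : ∀ q → suc ((suc (q + q) + 2) * q) ≡ suc (q + q) * q + suc (q + q)
  expand = ℕ-Solver.solve-∀

theorem2 : (p q : ℕ) → 0 < p → 0 < q →
    ∃[ n₀ ] ((n : ℕ) → n₀ < n → f6Bound n p q)
theorem2 (suc p′) q _ _ = T ^ L , λ n T^L<n → construction n T^L<n (integer-root (q + q) n)
  where
  L T : ℕ
  L = suc (q + q)
  T = (144 * L * 12 ^ L) ^ q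
  1≤T : 1 ≤ T
  1≤T = m^n>0 (144 * L * 12 ^ L) {{m*n≢0 (144 * L) (12 ^ L) {{_}} {{m^n≢0 12 L}}}} q
  construction : ∀ n → T ^ L < n → ∃[ e ] (e ^ L ≤ n × n < suc e ^ L) → f6Bound n (suc p′) q
  construction n T^L<n (e , e^L≤n , n<[1+e]^L) =
    colourCount e L , (colouring , colouring-rainbow) ,
    colourCount^q≤ L (suc p′) q 1≤e (s≤s z≤n) e^L≤n T≤e (exponent-gap p′ q)
    where
    open Behrend e L n (<⇒≤ n<[1+e]^L)
    T≤e : T ≤ e
    T≤e = s≤s⁻¹ (^-reflectsˡ-< L (<-trans T^L<n n<[1+e]^L))
    1≤e : 1 ≤ e
    1≤e = ≤-trans 1≤T T≤e
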